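{- Let $G$ be the graph constructed (as described in the context) from an instance $\langle \overline{X},\overline{C}\rangle$ of Exact 3-Cover with $|\overline{X}|=3q$, $q$ even. Then $\langle \overline{X},\overline{C}\rangle$ is a yes-instance of Exact 3-Cover if and only if $G$ has a Roman $\{3\}$-dominating function of weight $7q$.
   Context: A Roman $\{3\}$-dominating function on a graph $G=(V,E)$ is a function $f:V\to\{0,1,2,3\}$ such that for every $u\in V$: if $f(u)=0$ then $\sum_{v\in N(u)} f(v)\ge 3$, and if $f(u)=1$ then $\sum_{v\in N(u)} f(v)\ge 2$ ($N(u)$ the open neighbourhood); its weight is $\sum_{u\in V}f(u)$. An instance of Exact 3-Cover consists of a set $\overline{X}=\{\overline{x}_1,\dots,\overline{x}_{3q}\}$ and a collection $\overline{C}=\{\overline{C}_1,\dots,\overline{C}_t\}$ of 3-element subsets of $\overline{X}$; it is a yes-instance if some subcollection $\overline{C'}\subseteq\overline{C}$ contains every element of $\overline{X}$ in exactly one of its members. Here $q$ is assumed even. Construction of $G$: vertices $X=\{x_1,\dots,x_{3q}\}$, $C=\{c_1,\dots,c_t\}$, $A=\{a_1,\dots,a_{3q}\}$, $B=\{b_1,\dots,b_{3q}\}$, $Y=\{y_1,\dots,y_{10q}\}$, $Z=\{z_1,\dots,z_{10q}\}$. Edges: $x_ic_j$ whenever $\overline{x}_i\in\overline{C}_j$; $x_ia_i$ and $x_ib_i$ for each $i\in[3q]$; all edges among $A\cup B\cup C$ (so $A\cup B\cup C$ is a clique); $A$ is partitioned arbitrarily into $q/2$ pairwise disjoint 6-element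 sets $A^1,\dots,A^{q/2}$ and $Z$ into $q/2$ pairwise disjoint 20-element sets $Z^1,\dots,Z^{q/2}$, and for each $\ell$ the 20 vertices of $Z^\ell$ are put in bijection with the 20 three-element subsets of $A^\ell$, each vertex of $Z^\ell$ being made adjacent exactly to the three vertices of its triple; the same is done between $B$ and $Y$. There are no other edges. -}

module Defs where

open import Data.Bool using (Bool; true; false; _∧_; not; if_then_else_)
open import Data.Nat using (ℕ; _+_; _*_; _≤_)
open import Data.Fin using (Fin; zero; suc; _≟_)
open import Data.Fin.Subset using (Subset; _∈_)
open import Data.Vec using (_∷_; []; lookup)
open import Data.List using (List; map; _++_; concatMap; allFin)
open import Data.Nat.ListAction using (sum)
open import Data.Product using (Σ; _×_; _,_; proj₁; proj₂)
open import Relation.Nullary.Decidable using (⌊_⌋)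
open import Relation.Binary.PropositionalEquality using (_≡_)
open import Function.Bundles using (_↔_; Inverse)

-- A finite graph: a vertex type, a list enumerating every vertex exactly
-- once, and a (symmetric, irreflexive) Boolean adjacency relation.
record Graph : Set₁ where
  field
    Vtx      : Set
    vertices : List Vtx
    adj      : Vtx → Vtx → Bool

module _ (G : Graph) where
  open Graph G

  nbSum : (Vtx → ℕ) → Vtx → ℕ
  nbSum f u = sum (map (λ v → if adj u v then f v else 0) vertices)

  weight : (Vtx → ℕ) → ℕ
  weight f = sum (map f vertices)

  IsR3DF : (Vtx → ℕ) → Set
  IsR3DF f = (u : Vtx) →
      (f u ≤ 3)
    × (f u ≡ 0 → 3 ≤ nbSum f u)
    × (f u ≡ 1 → 2 ≤ nbSum f u)

  HasR3DFOfWeight : ℕ → Set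
  HasR3DFOfWeight w = Σ (Vtx → ℕ) λ f → IsR3DF f × weight f ≡ w

ExactCover : {n t : ℕ} → (Fin t → Subset n) → Set
ExactCover {n} {t} C =
  Σ (Subset t) λ S → (i : Fin n) →
      Σ (Fin t) (λ j → (j ∈ S) × (i ∈ C j))
    × ((j j′ : Fin t) → j ∈ S → i ∈ C j → j′ ∈ S → i ∈ C j′ → j ≡ j′)

-- The 20 three-element subsets of Fin 6 (lexicographic order);
-- triple is a bijection from Fin 20 onto the 3-subsets of Fin 6.

triple : Fin 20 → Subset 6
triple zero = true ∷ true ∷ true ∷ false ∷ false ∷ false ∷ []
triple (suc zero) = true ∷ true ∷ false ∷ true ∷ false ∷ false ∷ []
triple (suc (suc zero)) = true ∷ true ∷ false ∷ false ∷ true ∷ false ∷ []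
triple (suc (suc (suc zero))) = true ∷ true ∷ false ∷ false ∷ false ∷ true ∷ []
triple (suc (suc (suc (suc zero)))) = true ∷ false ∷ true ∷ true ∷ false ∷ false ∷ []
triple (suc (suc (suc (suc (suc zero))))) = true ∷ false ∷ true ∷ false ∷ true ∷ false ∷ []
triple (suc (suc (suc (suc (suc (suc zero)))))) = true ∷ false ∷ true ∷ false ∷ false ∷ true ∷ []
triple (suc (suc (suc (suc (suc (suc (suc zero))))))) = true ∷ false ∷ false ∷ true ∷ true ∷ false ∷ []
triple (suc (suc (suc (suc (suc (suc (suc (suc zero)))))))) = true ∷ false ∷ false ∷ true ∷ false ∷ true ∷ []
triple (suc (suc (suc (suc (suc (suc (suc (suc (suc zero))))))))) = true ∷ false ∷ false ∷ false ∷ true ∷ true ∷ []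
triple (suc (suc (suc (suc (suc (suc (suc (suc (suc (suc zero)))))))))) = false ∷ true ∷ true ∷ true ∷ false ∷ false ∷ []
triple (suc (suc (suc (suc (suc (suc (suc (suc (suc (suc (suc zero))))))))))) = false ∷ true ∷ true ∷ false ∷ true ∷ false ∷ []
triple (suc (suc (suc (suc (suc (suc (suc (suc (suc (suc (suc (suc zero)))))))))))) = false ∷ true ∷ true ∷ false ∷ false ∷ true ∷ []
triple (suc (suc (suc (suc (suc (suc (suc (suc (suc (suc (suc (suc (suc zero))))))))))))) = false ∷ true ∷ false ∷ true ∷ true ∷ false ∷ []
triple (suc (suc (suc (suc (suc (suc (suc (suc (suc (suc (suc (suc (suc (suc zero)))))))))))))) = false ∷ true ∷ false ∷ true ∷ false ∷ true ∷ []
triple (suc (suc (suc (suc (suc (suc (suc (suc (suc (suc (suc (suc (suc (suc (suc zero))))))))))))))) = false ∷ true ∷ false ∷ false ∷ true ∷ true ∷ []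
triple (suc (suc (suc (suc (suc (suc (suc (suc (suc (suc (suc (suc (suc (suc (suc (suc zero)))))))))))))))) = false ∷ false ∷ true ∷ true ∷ true ∷ false ∷ []
triple (suc (suc (suc (suc (suc (suc (suc (suc (suc (suc (suc (suc (suc (suc (suc (suc (suc zero))))))))))))))))) = false ∷ false ∷ true ∷ true ∷ false ∷ true ∷ []
triple (suc (suc (suc (suc (suc (suc (suc (suc (suc (suc (suc (suc (suc (suc (suc (suc (suc (suc zero)))))))))))))))))) = false ∷ false ∷ true ∷ false ∷ true ∷ true ∷ []
triple (suc (suc (suc (suc (suc (suc (suc (suc (suc (suc (suc (suc (suc (suc (suc (suc (suc (suc (suc zero))))))))))))))))))) = false ∷ false ∷ false ∷ true ∷ true ∷ true ∷ []

-- The reduction graph.  n = 3q ground elements, t sets, m = q/2 blocks.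
-- x i, a i, b i : i ∈ Fin n;  c j : j ∈ Fin t;
-- y ℓ k, z ℓ k  : ℓ ∈ Fin m, k ∈ Fin 20 (the k-th triple of block ℓ),
-- so Z^ℓ = { z ℓ k } and Y^ℓ = { y ℓ k } each have 20 vertices.
-- The partition of A into blocks A^1..A^m of size 6 is given by a bijection
-- πA : Fin n ↔ Fin m × Fin 6 (a i ∈ A^ℓ iff proj₁ (πA i) = ℓ); likewise πB.

data V (n t m : ℕ) : Set where
  x a b : Fin n → V n t m
  c     : Fin t → V n t m
  y z   : Fin m → Fin 20 → V n t m

eqB : {k : ℕ} → Fin k → Fin k → Bool
eqB i j = ⌊ i ≟ j ⌋

module Construction {n t m : ℕ} (C : Fin t → Subset n)
                    (πA πB : Fin n ↔ (Fin m × Fin 6)) where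

  inC : Fin n → Fin t → Bool
  inC i j = lookup (C j) i

  -- the vertex (ℓ , k) of Z (resp. Y) is adjacent to the element i of A (resp. B)
  -- iff i lies in block ℓ and its position in the block is in the k-th triple
  blk : Fin n ↔ (Fin m × Fin 6) → Fin m → Fin 20 → Fin n → Bool
  blk π ℓ k i = eqB ℓ (proj₁ (Inverse.to π i)) ∧ lookup (triple k) (proj₂ (Inverse.to π i))

  adjG : V n t m → V n t m → Bool
  adjG (x i) (a i′) = eqB i i′
  adjG (x i) (b i′) = eqB i i′
  adjG (x i) (c j)  = inC i j
  adjG (a i) (x i′) = eqB i i′
  adjG (a i) (a i′) = not (eqB i i′)
  adjG (a i) (b i′) = true
  adjG (a i) (c j)  = true
  adjG (a i) (z ℓ k) = blk πA ℓ k i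
  adjG (b i) (x i′) = eqB i i′
  adjG (b i) (a i′) = true
  adjG (b i) (b i′) = not (eqB i i′)
  adjG (b i) (c j)  = true
  adjG (b i) (y ℓ k) = blk πB ℓ k i
  adjG (c j) (x i)  = inC i j
  adjG (c j) (a i)  = true
  adjG (c j) (b i)  = true
  adjG (c j) (c j′) = not (eqB j j′)
  adjG (y ℓ k) (b i) = blk πB ℓ k i
  adjG (z ℓ k) (a i) = blk πA ℓ k i
  adjG _ _ = false

  allV : List (V n t m)
  allV = map x (allFin n) ++ map a (allFin n) ++ map b (allFin n)
      ++ map c (allFin t)
      ++ concatMap (λ ℓ → map (y ℓ) (allFin 20)) (allFin m)
      ++ concatMap (λ ℓ → map (z ℓ) (allFin 20)) (allFin m)

  G : Graph
  G = record { Vtx = V n t m ; vertices = allV ; adj = adjG }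

-- Forward: for an exact cover S, label every vertex of A ∪ B and every c_j with j ∈ S by 1.
-- Each x_i then sees a_i, b_i and exactly one chosen set, each y, z sees three 1s, and the
-- weight is 3q + 3q + q.
--
-- Backward: let f have weight 7q, call a label heavy if it is at least 2, and let K_i count
-- the positively labelled sets containing element i. A block A^ℓ with its 20 triple vertices
-- Z^ℓ weighs at least 6 + h/2, where h counts the heavy labels on A^ℓ (a finite check, since
-- each z needs at least minLabel of the sum over its triple); likewise for B and Y. Each
-- element satisfies max(1, K_i) ≤ K_i + f(x_i) + [a_i heavy] + [b_i heavy], because for
-- K_i = 0 and f(x_i) = 0 the vertex x_i is dominated by a_i and b_i alone. As every set has
-- three elements, Σ K_i ≤ 3 Σ f(c_j). Adding up, w(f) ≥ 7q + (4 Σ f(x_i) + H + 2 Σ (K_i − 1))/6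
-- with H the number of heavy labels, so every K_i = 1 and the positively labelled sets form an
-- exact cover.

module Submission where

open import Defs
open import Data.Bool using (Bool; true; false; _∧_; if_then_else_)
open import Data.Empty using (⊥-elim)
open import Data.Fin using (Fin; zero; suc; _↑ˡ_; _↑ʳ_; combine; remQuot)
open import Data.Fin.Properties using (*↔×; remQuot-combine; all?) renaming (_≟_ to _≟ᶠ_)
open import Data.Fin.Subset using (Subset; ∣_∣; _∈_)
open import Data.Fin.Subset.Properties using (∣p∣≤n)
open import Data.List using (List; []; _∷_; map; _++_; concatMap; allFin; upTo; cartesianProductWith)
import Data.List as List
open import Data.List.Membership.Propositional using () renaming (_∈_ to _∈ₗ_)
open import Data.List.Membership.Propositional.Properties using (∈-cartesianProductWith⁺; ∈-upTo⁺)
open import Data.List.Properties using (map-++; map-tabulate)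
import Data.List.Relation.Unary.All as ListAll
open import Data.List.Relation.Unary.Any using (here)
open import Data.Nat
open import Data.Nat.ListAction using () renaming (sum to sumₗ)
open import Data.Nat.ListAction.Properties using (sum-++)
open import Data.Nat.Properties
open import Data.Nat.Tactic.RingSolver using (solve-∀)
open import Data.Product using (Σ; ∃-syntax; _×_; _,_; proj₁; proj₂)
open import Data.Vec using (Vec; []; _∷_; lookup)
import Data.Vec as Vec
open import Data.Vec.Properties using (lookup⇒[]=; []=⇒lookup; lookup∘tabulate)
import Data.Vec.Relation.Unary.All as VecAll
open import Data.Vec.Relation.Unary.All.Properties using (tabulate⁺)
open import Function using (_∘_; id; _↔_; _⇔_; Inverse; mk⇔)
open import Function.Properties.Inverse using (↔-sym; ↔-trans)
open import Relation.Binary.PropositionalEquality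
open import Relation.Nullary using (Dec; yes; no)
open import Relation.Nullary.Decidable using (from-yes; decidable-stable)

open import Algebra.Properties.Semiring.Sum +-*-semiring
  using (sum; sum-syntax; sum-cong-≗; sum-replicate-zero; ∑-comm; ∑-distrib-+; ∑-permute; *-distribˡ-sum)

private variable
  k n t : ℕ

∑-const : ∀ n w → ∑[ i < n ] w ≡ n * w
∑-const zero    w = refl
∑-const (suc n) w = cong (w +_) (∑-const n w)

∑-mono-≤ : {f g : Fin n → ℕ} → (∀ i → f i ≤ g i) → sum f ≤ sum g
∑-mono-≤ {zero}  f≤g = z≤n
∑-mono-≤ {suc n} f≤g = +-mono-≤ (f≤g zero) (∑-mono-≤ (f≤g ∘ suc))

term≤∑ : (f : Fin n → ℕ) (i : Fin n) → f i ≤ sum f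
term≤∑ f zero    = m≤m+n _ _
term≤∑ f (suc i) = ≤-trans (term≤∑ (f ∘ suc) i) (m≤n+m _ _)

pair≤∑ : (f : Fin n → ℕ) {i j : Fin n} → i ≢ j → f i + f j ≤ sum f
pair≤∑ f {zero}  {zero}  i≢j = ⊥-elim (i≢j refl)
pair≤∑ f {zero}  {suc j} _   = +-monoʳ-≤ (f zero) (term≤∑ (f ∘ suc) j)
pair≤∑ f {suc i} {zero}  _   =
  subst (_≤ sum f) (+-comm (f zero) (f (suc i))) (+-monoʳ-≤ (f zero) (term≤∑ (f ∘ suc) i))
pair≤∑ f {suc i} {suc j} i≢j = ≤-trans (pair≤∑ (f ∘ suc) (i≢j ∘ cong suc)) (m≤n+m _ _)

∑≡0⇒≡0 : (f : Fin n → ℕ) → sum f ≡ 0 → ∀ i → f i ≡ 0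
∑≡0⇒≡0 f ∑f≡0 i = n≤0⇒n≡0 (subst (f i ≤_) ∑f≡0 (term≤∑ f i))

∑>0⇒∃>0 : (f : Fin n → ℕ) → 0 < sum f → ∃[ i ] 0 < f i
∑>0⇒∃>0 {suc n} f 0<∑ with f zero in eq
... | suc _ = zero , subst (0 <_) (sym eq) (s≤s z≤n)
... | zero  with i , 0<fi ← ∑>0⇒∃>0 (f ∘ suc) 0<∑ = suc i , 0<fi

∑-select : (i : Fin n) (g : Fin n → ℕ) → ∑[ j < n ] (if eqB i j then g j else 0) ≡ g i
∑-select {suc n} zero    g = trans (cong (g zero +_) (sum-replicate-zero n)) (+-identityʳ _)
∑-select {suc n} (suc i) g =
  trans (sum-cong-≗ λ j → cong (λ β → if β then g (suc j) else 0) (eqB-suc j)) (∑-select i (g ∘ suc))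
  where
  eqB-suc : ∀ j → eqB (suc i) (suc j) ≡ eqB i j
  eqB-suc j with i ≟ᶠ j
  ... | yes _ = refl
  ... | no  _ = refl

∑-∈ : (p : Subset n) (w : ℕ) → ∑[ i < n ] (if lookup p i then w else 0) ≡ ∣ p ∣ * w
∑-∈ []          w = refl
∑-∈ (true  ∷ p) w = cong (w +_) (∑-∈ p w)
∑-∈ (false ∷ p) w = ∑-∈ p w

∑-↑ : ∀ k r (g : Fin (k + r) → ℕ) → sum g ≡ ∑[ i < k ] g (i ↑ˡ r) + ∑[ j < r ] g (k ↑ʳ j)
∑-↑ zero    r g = refl
∑-↑ (suc k) r g = trans (cong (g zero +_) (∑-↑ k r (g ∘ suc))) (sym (+-assoc (g zero) _ _))

∑-combine : ∀ m k (g : Fin (m * k) → ℕ) → sum g ≡ ∑[ ℓ < m ] ∑[ p < k ] g (combine ℓ p)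
∑-combine zero    k g = refl
∑-combine (suc m) k g =
  trans (∑-↑ k (m * k) g) (cong (∑[ p < k ] g (p ↑ˡ (m * k)) +_) (∑-combine m k (g ∘ (k ↑ʳ_))))

∑-↔× : {N m k : ℕ} (π : Fin N ↔ (Fin m × Fin k)) (F : Fin N → ℕ) →
       sum F ≡ ∑[ ℓ < m ] ∑[ p < k ] F (Inverse.from π (ℓ , p))
∑-↔× {N} {m} {k} π F = begin
  sum F                                                     ≡⟨ ∑-permute F (↔-trans *↔× (↔-sym π)) ⟩
  ∑[ r < m * k ] F (from (remQuot k r))                     ≡⟨ ∑-combine m k _ ⟩
  ∑[ ℓ < m ] ∑[ p < k ] F (from (remQuot k (combine ℓ p)))
    ≡⟨ sum-cong-≗ (λ ℓ → sum-cong-≗ λ p → cong (F ∘ from) (remQuot-combine ℓ p)) ⟩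
  ∑[ ℓ < m ] ∑[ p < k ] F (from (ℓ , p))                    ∎
  where open Inverse π; open ≡-Reasoning

module _ {A : Set} (g : A → ℕ) where

  sumₗ-map-tabulate : (h : Fin n → A) → sumₗ (map g (List.tabulate h)) ≡ ∑[ i < n ] g (h i)
  sumₗ-map-tabulate {zero}  h = refl
  sumₗ-map-tabulate {suc n} h = cong (g (h zero) +_) (sumₗ-map-tabulate (h ∘ suc))

  sumₗ-map-allFin : (h : Fin n → A) → sumₗ (map g (map h (allFin n))) ≡ ∑[ i < n ] g (h i)
  sumₗ-map-allFin h = trans (cong (sumₗ ∘ map g) (map-tabulate id h)) (sumₗ-map-tabulate h)

  sumₗ-map-++ : ∀ xs ys → sumₗ (map g (xs ++ ys)) ≡ sumₗ (map g xs) + sumₗ (map g ys)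
  sumₗ-map-++ xs ys = trans (cong sumₗ (map-++ g xs ys)) (sum-++ (map g xs) (map g ys))

  sumₗ-map-concatMap : {B : Set} (h : B → List A) (us : List B) →
                       sumₗ (map g (concatMap h us)) ≡ sumₗ (map (λ u → sumₗ (map g (h u))) us)
  sumₗ-map-concatMap h []       = refl
  sumₗ-map-concatMap h (u ∷ us) =
    trans (sumₗ-map-++ (h u) (concatMap h us)) (cong (sumₗ (map g (h u)) +_) (sumₗ-map-concatMap h us))

𝟙 : Bool → ℕ
𝟙 β = if β then 1 else 0

𝟙≤1 : ∀ β → 𝟙 β ≤ 1
𝟙≤1 true  = ≤-refl
𝟙≤1 false = z≤n

𝟙-∧ : ∀ β γ → 𝟙 (β ∧ γ) ≡ (if γ then 𝟙 β else 0)
𝟙-∧ true  true  = refl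
𝟙-∧ true  false = refl
𝟙-∧ false true  = refl
𝟙-∧ false false = refl

0<𝟙-∧ : ∀ {β γ} → 0 < 𝟙 (β ∧ γ) → β ≡ true × γ ≡ true
0<𝟙-∧ {true} {true} _ = refl , refl

module _ (C : Fin t → Subset n) where

  coverCount : Subset t → Fin n → ℕ
  coverCount S i = ∑[ j < t ] 𝟙 (lookup S j ∧ lookup (C j) i)

  unique⇒coverCount≡1 : {S : Subset t} {i : Fin n} (j₀ : Fin t) → j₀ ∈ S → i ∈ C j₀ →
                        (∀ j → j ∈ S → i ∈ C j → j₀ ≡ j) → coverCount S i ≡ 1
  unique⇒coverCount≡1 {S} {i} j₀ j₀∈S i∈Cj₀ unique =
    trans (sum-cong-≗ term≡δ) (∑-select j₀ (λ _ → 1))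
    where
    term≡δ : ∀ j → 𝟙 (lookup S j ∧ lookup (C j) i) ≡ 𝟙 (eqB j₀ j)
    term≡δ j with j₀ ≟ᶠ j
    ... | yes refl rewrite []=⇒lookup j₀∈S | []=⇒lookup i∈Cj₀ = refl
    ... | no j₀≢j with lookup S j in j∈S | lookup (C j) i in i∈Cj
    ...   | true  | true  = ⊥-elim (j₀≢j (unique j (lookup⇒[]= j S j∈S) (lookup⇒[]= i (C j) i∈Cj)))
    ...   | true  | false = refl
    ...   | false | _     = refl

  exactCover⇒coverCount≡1 : ((S , _) : ExactCover C) → ∀ i → coverCount S i ≡ 1
  exactCover⇒coverCount≡1 (S , cover) i with (j₀ , j₀∈S , i∈Cj₀) , unique ← cover i =
    unique⇒coverCount≡1 j₀ j₀∈S i∈Cj₀ (λ j → unique j₀ j j₀∈S i∈Cj₀)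

  coverCount≡1⇒exactCover : (S : Subset t) → (∀ i → coverCount S i ≡ 1) → ExactCover C
  coverCount≡1⇒exactCover S once = S , λ i → covered i , unique i
    where
    covered : ∀ i → Σ (Fin t) λ j → j ∈ S × i ∈ C j
    covered i with j , 0<term ← ∑>0⇒∃>0 _ (subst (0 <_) (sym (once i)) (s≤s z≤n))
                 with j∈S , i∈Cj ← 0<𝟙-∧ {lookup S j} 0<term
      = j , lookup⇒[]= j S j∈S , lookup⇒[]= i (C j) i∈Cj
    term≡1 : ∀ {i j} → j ∈ S → i ∈ C j → 𝟙 (lookup S j ∧ lookup (C j) i) ≡ 1
    term≡1 j∈S i∈Cj rewrite []=⇒lookup j∈S | []=⇒lookup i∈Cj = refl
    unique : ∀ i j j′ → j ∈ S → i ∈ C j → j′ ∈ S → i ∈ C j′ → j ≡ j′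
    unique i j j′ j∈S i∈Cj j′∈S i∈Cj′ =
      decidable-stable (j ≟ᶠ j′) λ j≢j′ → <-irrefl refl (begin-strict
      1               <⟨ s≤s (s≤s z≤n) ⟩
      2               ≡⟨ cong₂ _+_ (term≡1 j∈S i∈Cj) (term≡1 j′∈S i∈Cj′) ⟨
      _               ≤⟨ pair≤∑ _ j≢j′ ⟩
      coverCount S i  ≡⟨ once i ⟩
      1               ∎)
      where open ≤-Reasoning

  ∑-coverCount : (∀ j → ∣ C j ∣ ≡ 3) → (S : Subset t) →
                 ∑[ i < n ] coverCount S i ≡ 3 * ∑[ j < t ] 𝟙 (lookup S j)
  ∑-coverCount ∣C∣≡3 S = begin
    ∑[ i < n ] ∑[ j < t ] 𝟙 (lookup S j ∧ lookup (C j) i)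
      ≡⟨ ∑-comm (λ i j → 𝟙 (lookup S j ∧ lookup (C j) i)) ⟩
    ∑[ j < t ] ∑[ i < n ] 𝟙 (lookup S j ∧ lookup (C j) i)
      ≡⟨ sum-cong-≗ (λ j → sum-cong-≗ λ i → 𝟙-∧ (lookup S j) (lookup (C j) i)) ⟩
    ∑[ j < t ] ∑[ i < n ] (if lookup (C j) i then 𝟙 (lookup S j) else 0)
      ≡⟨ sum-cong-≗ (λ j → trans (∑-∈ (C j) _) (cong (_* 𝟙 (lookup S j)) (∣C∣≡3 j))) ⟩
    ∑[ j < t ] (3 * 𝟙 (lookup S j))
      ≡⟨ *-distribˡ-sum 3 (𝟙 ∘ lookup S) ⟨
    3 * ∑[ j < t ] 𝟙 (lookup S j) ∎
    where open ≡-Reasoning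

minLabel : ℕ → ℕ
minLabel 0 = 2
minLabel 1 = 2
minLabel 2 = 1
minLabel _ = 0

minLabel-≤ : (G : Graph) {f : Graph.Vtx G → ℕ} → IsR3DF G f → ∀ u → minLabel (nbSum G f u) ≤ f u
minLabel-≤ G {f} isR u = bound (f u) (nbSum G f u) (proj₁ (proj₂ (isR u))) (proj₂ (proj₂ (isR u)))
  where
  bound : ∀ w s → (w ≡ 0 → 3 ≤ s) → (w ≡ 1 → 2 ≤ s) → minLabel s ≤ w
  bound _             (suc (suc (suc _))) _ _ = z≤n
  bound 0             0                   h _ with () ← h refl
  bound 0             1                   h _ with s≤s () ← h refl
  bound 0             2                   h _ with s≤s (s≤s ()) ← h refl
  bound 1             0                   _ h with () ← h refl
  bound 1             1                   _ h with s≤s () ← h refl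
  bound 1             2                   _ _ = s≤s z≤n
  bound (suc (suc _)) 0                   _ _ = s≤s (s≤s z≤n)
  bound (suc (suc _)) 1                   _ _ = s≤s (s≤s z≤n)
  bound (suc (suc _)) 2                   _ _ = s≤s z≤n

heavy : ℕ → ℕ
heavy (suc (suc _)) = 1
heavy _             = 0

heavy-pair : ∀ α β → 3 ≤ α + β → 1 ≤ heavy α + heavy β
heavy-pair (suc (suc _)) _             _              = s≤s z≤n
heavy-pair 0             (suc (suc _)) _              = s≤s z≤n
heavy-pair 1             (suc (suc _)) _              = s≤s z≤n
heavy-pair 0             0             ()
heavy-pair 0             1             (s≤s ())
heavy-pair 1             0             (s≤s ())
heavy-pair 1             1             (s≤s (s≤s ()))

-- For an element: K positively labelled sets contain it, cov is the label sum of all sets containing it.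
element-bound : ∀ K ξ α β cov → cov ≤ 3 * K → (ξ ≡ 0 → 3 ≤ α + (β + cov)) →
                1 + (K ∸ 1) ≤ K + (ξ + (heavy α + heavy β))
element-bound (suc K) _       _ _ _ _ _ = s≤s (m≤m+n K _)
element-bound 0       (suc _) _ _ _ _ _ = s≤s z≤n
element-bound 0       0       α β cov cov≤0 dominated with refl ← n≤0⇒n≡0 cov≤0 =
  heavy-pair α β (subst (3 ≤_) (cong (α +_) (+-identityʳ β)) (dominated refl))

tripleSum : (Fin 6 → ℕ) → Fin 20 → ℕ
tripleSum v k = ∑[ p < 6 ] (if lookup (triple k) p then v p else 0)

∣triple∣≡3 : ∀ k → ∣ triple k ∣ ≡ 3
∣triple∣≡3 = from-yes (all? λ k → ∣ triple k ∣ ≟ 3)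

BlockBound : (Fin 6 → ℕ) → Set
BlockBound v = 12 + ∑[ p < 6 ] heavy (v p) ≤ 2 * (∑[ p < 6 ] v p + ∑[ k < 20 ] minLabel (tripleSum v k))

blockBound? : ∀ v → Dec (BlockBound v)
blockBound? v = _ ≤? _

vecsBelow : (k bound : ℕ) → List (Vec ℕ k)
vecsBelow zero    bound = List.[ [] ]
vecsBelow (suc k) bound = cartesianProductWith _∷_ (upTo bound) (vecsBelow k bound)

∈-vecsBelow : ∀ {bound} (xs : Vec ℕ k) → VecAll.All (_< bound) xs → xs ∈ₗ vecsBelow k bound
∈-vecsBelow []       VecAll.[]                = here refl
∈-vecsBelow (_ ∷ xs) (x<bound VecAll.∷ xs<bound) =
  ∈-cartesianProductWith⁺ _∷_ (∈-upTo⁺ x<bound) (∈-vecsBelow xs xs<bound)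

blockBound-table : ListAll.All (BlockBound ∘ lookup) (vecsBelow 6 4)
blockBound-table = from-yes (ListAll.all? (blockBound? ∘ lookup) (vecsBelow 6 4))

blockBound : (v : Fin 6 → ℕ) → (∀ p → v p ≤ 3) → BlockBound v
blockBound v v≤3 = ListAll.lookup blockBound-table (∈-vecsBelow (Vec.tabulate v) (tabulate⁺ (s≤s ∘ v≤3)))

blocks-bound : {N m : ℕ} (π : Fin N ↔ (Fin m × Fin 6)) (α : Fin N → ℕ) (w : Fin m → Fin 20 → ℕ) →
  (∀ i → α i ≤ 3) → (∀ ℓ k → minLabel (tripleSum (λ p → α (Inverse.from π (ℓ , p))) k) ≤ w ℓ k) →
  m * 12 + ∑[ i < N ] heavy (α i) ≤ 2 * (∑[ i < N ] α i + ∑[ ℓ < m ] ∑[ k < 20 ] w ℓ k)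
blocks-bound {N} {m} π α w α≤3 w≥ = begin
  m * 12 + ∑[ i < N ] heavy (α i)
    ≡⟨ cong₂ _+_ (sym (∑-const m 12)) (∑-↔× π (heavy ∘ α)) ⟩
  ∑[ ℓ < m ] 12 + ∑[ ℓ < m ] ∑[ p < 6 ] heavy (block ℓ p)
    ≡⟨ ∑-distrib-+ (λ _ → 12) (λ ℓ → ∑[ p < 6 ] heavy (block ℓ p)) ⟨
  ∑[ ℓ < m ] (12 + ∑[ p < 6 ] heavy (block ℓ p))
    ≤⟨ ∑-mono-≤ block-bound ⟩
  ∑[ ℓ < m ] (2 * (∑[ p < 6 ] block ℓ p + ∑[ k < 20 ] w ℓ k))
    ≡⟨ *-distribˡ-sum 2 (λ ℓ → ∑[ p < 6 ] block ℓ p + ∑[ k < 20 ] w ℓ k) ⟨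
  2 * ∑[ ℓ < m ] (∑[ p < 6 ] block ℓ p + ∑[ k < 20 ] w ℓ k)
    ≡⟨ cong (2 *_) (∑-distrib-+ (λ ℓ → ∑[ p < 6 ] block ℓ p) (λ ℓ → ∑[ k < 20 ] w ℓ k)) ⟩
  2 * (∑[ ℓ < m ] ∑[ p < 6 ] block ℓ p + ∑[ ℓ < m ] ∑[ k < 20 ] w ℓ k)
    ≡⟨ cong (λ s → 2 * (s + ∑[ ℓ < m ] ∑[ k < 20 ] w ℓ k)) (∑-↔× π α) ⟨
  2 * (∑[ i < N ] α i + ∑[ ℓ < m ] ∑[ k < 20 ] w ℓ k) ∎
  where
  open ≤-Reasoning
  block : Fin m → Fin 6 → ℕ
  block ℓ p = α (Inverse.from π (ℓ , p))
  block-bound : ∀ ℓ → 12 + ∑[ p < 6 ] heavy (block ℓ p) ≤ 2 * (∑[ p < 6 ] block ℓ p + ∑[ k < 20 ] w ℓ k)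
  block-bound ℓ = ≤-trans (blockBound (block ℓ) (λ p → α≤3 _))
                          (*-monoʳ-≤ 2 (+-monoʳ-≤ (∑[ p < 6 ] block ℓ p) (∑-mono-≤ (w≥ ℓ))))

-- 3 · (the two block bounds) + 2 · (the element bound, with KS ≤ 3Γ), compared with 6 · weight.
weight-budget : ∀ m X A B Γ Y Z HA HB D KS →
  X + (A + (B + (Γ + (Y + Z)))) ≡ 14 * m →
  m * 12 + HA ≤ 2 * (A + Z) → m * 12 + HB ≤ 2 * (B + Y) →
  6 * m + D ≤ KS + (X + (HA + HB)) → KS ≤ 3 * Γ →
  D + (X + (HA + HB)) ≡ 0
weight-budget m X A B Γ Y Z HA HB D KS weight≡ boundA boundB boundX KS≤ =
  n≤0⇒n≡0 (≤-trans (m≤m+n _ (D + 3 * X)) (+-cancelˡ-≤ base _ 0 combined))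
  where
  open ≤-Reasoning
  base : ℕ
  base = 84 * m + 2 * X + 2 * (HA + HB)
  combined : base + (D + (X + (HA + HB)) + (D + 3 * X)) ≤ base + 0
  combined = begin
    base + (D + (X + (HA + HB)) + (D + 3 * X))
      ≡⟨ split m X HA HB D ⟩
    3 * (m * 12 + HA) + 3 * (m * 12 + HB) + 2 * (6 * m + D) + 6 * X
      ≤⟨ +-monoˡ-≤ (6 * X) (+-mono-≤ (+-mono-≤ (*-monoʳ-≤ 3 boundA) (*-monoʳ-≤ 3 boundB))
                                      (*-monoʳ-≤ 2 (≤-trans boundX (+-monoˡ-≤ (X + (HA + HB)) KS≤)))) ⟩
    3 * (2 * (A + Z)) + 3 * (2 * (B + Y)) + 2 * (3 * Γ + (X + (HA + HB))) + 6 * X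
      ≡⟨ regroup X A B Γ Y Z HA HB ⟩
    6 * (X + (A + (B + (Γ + (Y + Z))))) + (2 * X + 2 * (HA + HB))
      ≡⟨ cong (λ w → 6 * w + (2 * X + 2 * (HA + HB))) weight≡ ⟩
    6 * (14 * m) + (2 * X + 2 * (HA + HB))
      ≡⟨ total m X HA HB ⟩
    base + 0 ∎
    where
    split : ∀ m X HA HB D → 84 * m + 2 * X + 2 * (HA + HB) + (D + (X + (HA + HB)) + (D + 3 * X))
                          ≡ 3 * (m * 12 + HA) + 3 * (m * 12 + HB) + 2 * (6 * m + D) + 6 * X
    split = solve-∀
    regroup : ∀ X A B Γ Y Z HA HB →
      3 * (2 * (A + Z)) + 3 * (2 * (B + Y)) + 2 * (3 * Γ + (X + (HA + HB))) + 6 * X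
        ≡ 6 * (X + (A + (B + (Γ + (Y + Z))))) + (2 * X + 2 * (HA + HB))
    regroup = solve-∀
    total : ∀ m X HA HB → 6 * (14 * m) + (2 * X + 2 * (HA + HB)) ≡ 84 * m + 2 * X + 2 * (HA + HB) + 0
    total = solve-∀

module Reduction {n t m : ℕ} (C : Fin t → Subset n) (πA πB : Fin n ↔ (Fin m × Fin 6)) where
  open Construction C πA πB

  weight≡ : (g : V n t m → ℕ) {sx sa sb sc sy sz : ℕ} →
    ∑[ i < n ] g (x i) ≡ sx → ∑[ i < n ] g (a i) ≡ sa → ∑[ i < n ] g (b i) ≡ sb →
    ∑[ j < t ] g (c j) ≡ sc →
    ∑[ ℓ < m ] ∑[ k < 20 ] g (y ℓ k) ≡ sy → ∑[ ℓ < m ] ∑[ k < 20 ] g (z ℓ k) ≡ sz →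
    weight G g ≡ sx + (sa + (sb + (sc + (sy + sz))))
  weight≡ g ex ea eb ec ey ez =
    part x ex (part a ea (part b eb (part c ec
      (trans (sumₗ-map-++ g (blockList y) (blockList z)) (cong₂ _+_ (blocks y ey) (blocks z ez))))))
    where
    part : (h : Fin k → V n t m) {ys : List (V n t m)} {s r : ℕ} → ∑[ i < k ] g (h i) ≡ s →
           sumₗ (map g ys) ≡ r → sumₗ (map g (map h (allFin k) ++ ys)) ≡ s + r
    part h {ys} e rest =
      trans (sumₗ-map-++ g (map h (allFin _)) ys) (cong₂ _+_ (trans (sumₗ-map-allFin g h) e) rest)
    blockList : (Fin m → Fin 20 → V n t m) → List (V n t m)
    blockList h = concatMap (λ ℓ → map (h ℓ) (allFin 20)) (allFin m)
    blocks : (h : Fin m → Fin 20 → V n t m) {s : ℕ} → ∑[ ℓ < m ] ∑[ k < 20 ] g (h ℓ k) ≡ s →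
             sumₗ (map g (blockList h)) ≡ s
    blocks h e = trans (sumₗ-map-concatMap g _ (allFin m))
                 (trans (sumₗ-map-tabulate (λ ℓ → sumₗ (map g (map (h ℓ) (allFin 20)))) id)
                        (trans (sum-cong-≗ λ ℓ → sumₗ-map-allFin g (h ℓ)) e))

  ∑a≤weight : (g : V n t m → ℕ) → ∑[ i < n ] g (a i) ≤ weight G g
  ∑a≤weight g = subst (∑a ≤_) (sym (weight≡ g refl refl refl refl refl refl))
                      (≤-trans (m≤m+n ∑a _) (m≤n+m _ (∑[ i < n ] g (x i))))
    where
    ∑a : ℕ
    ∑a = ∑[ i < n ] g (a i)

  ∑b≤weight : (g : V n t m → ℕ) → ∑[ i < n ] g (b i) ≤ weight G g
  ∑b≤weight g = subst (∑b ≤_) (sym (weight≡ g refl refl refl refl refl refl))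
                      (≤-trans (m≤m+n ∑b _)
                               (≤-trans (m≤n+m _ (∑[ i < n ] g (a i))) (m≤n+m _ (∑[ i < n ] g (x i)))))
    where
    ∑b : ℕ
    ∑b = ∑[ i < n ] g (b i)

  ∑-blk : (π : Fin n ↔ (Fin m × Fin 6)) (g : Fin n → ℕ) (ℓ : Fin m) (k : Fin 20) →
          ∑[ i < n ] (if blk π ℓ k i then g i else 0) ≡ tripleSum (λ p → g (Inverse.from π (ℓ , p))) k
  ∑-blk π g ℓ k = begin
    ∑[ i < n ] (if blk π ℓ k i then g i else 0)
      ≡⟨ ∑-↔× π _ ⟩
    ∑[ ℓ′ < m ] ∑[ p < 6 ] (if blk π ℓ k (from (ℓ′ , p)) then g (from (ℓ′ , p)) else 0)
      ≡⟨ sum-cong-≗ (λ ℓ′ → sum-cong-≗ λ p →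
           cong (guarded (g (from (ℓ′ , p)))) (strictlyInverseˡ (ℓ′ , p))) ⟩
    ∑[ ℓ′ < m ] ∑[ p < 6 ] (if eqB ℓ ℓ′ ∧ lookup (triple k) p then g (from (ℓ′ , p)) else 0)
      ≡⟨ sum-cong-≗ (λ ℓ′ → pull-out (eqB ℓ ℓ′) ℓ′) ⟩
    ∑[ ℓ′ < m ] (if eqB ℓ ℓ′ then tripleSum (λ p → g (from (ℓ′ , p))) k else 0)
      ≡⟨ ∑-select ℓ (λ ℓ′ → tripleSum (λ p → g (from (ℓ′ , p))) k) ⟩
    tripleSum (λ p → g (from (ℓ , p))) k ∎
    where
    open Inverse π
    open ≡-Reasoning
    guarded : ℕ → Fin m × Fin 6 → ℕ
    guarded w (ℓ′ , p) = if eqB ℓ ℓ′ ∧ lookup (triple k) p then w else 0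
    pull-out : ∀ e ℓ′ → ∑[ p < 6 ] (if e ∧ lookup (triple k) p then g (from (ℓ′ , p)) else 0)
                       ≡ (if e then tripleSum (λ p → g (from (ℓ′ , p))) k else 0)
    pull-out true  _ = refl
    pull-out false _ = refl

  nbSum-x : (f : V n t m → ℕ) (i : Fin n) →
            nbSum G f (x i) ≡ f (a i) + (f (b i) + ∑[ j < t ] (if inC i j then f (c j) else 0))
  nbSum-x f i =
    trans (weight≡ _ (sum-replicate-zero n) (∑-select i (f ∘ a)) (∑-select i (f ∘ b)) refl
                     (sum-replicate-zero m) (sum-replicate-zero m))
          (cong (λ s → f (a i) + (f (b i) + s)) (+-identityʳ _))

  nbSum-y : (f : V n t m → ℕ) (ℓ : Fin m) (k : Fin 20) →
            nbSum G f (y ℓ k) ≡ tripleSum (λ p → f (b (Inverse.from πB (ℓ , p)))) k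
  nbSum-y f ℓ k =
    trans (weight≡ _ (sum-replicate-zero n) (sum-replicate-zero n) (∑-blk πB (f ∘ b) ℓ k)
                     (sum-replicate-zero t) (sum-replicate-zero m) (sum-replicate-zero m))
          (+-identityʳ _)

  nbSum-z : (f : V n t m → ℕ) (ℓ : Fin m) (k : Fin 20) →
            nbSum G f (z ℓ k) ≡ tripleSum (λ p → f (a (Inverse.from πA (ℓ , p)))) k
  nbSum-z f ℓ k =
    trans (weight≡ _ (sum-replicate-zero n) (∑-blk πA (f ∘ a) ℓ k) (sum-replicate-zero n)
                     (sum-replicate-zero t) (sum-replicate-zero m) (sum-replicate-zero m))
          (+-identityʳ _)

module Forward (q : ℕ) {t m : ℕ} (C : Fin t → Subset (3 * q)) (∣C∣≡3 : ∀ j → ∣ C j ∣ ≡ 3)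
               (πA πB : Fin (3 * q) ↔ (Fin m × Fin 6)) where
  open Construction C πA πB
  open Reduction C πA πB

  coverLabel : Subset t → V (3 * q) t m → ℕ
  coverLabel S (a _) = 1
  coverLabel S (b _) = 1
  coverLabel S (c j) = 𝟙 (lookup S j)
  coverLabel S _     = 0

  exactCover⇒R3DF : ExactCover C → HasR3DFOfWeight G (7 * q)
  exactCover⇒R3DF cover@(S , covers) = f , dominating , weight≡7q
    where
    f : V (3 * q) t m → ℕ
    f = coverLabel S

    once : ∀ i → coverCount C S i ≡ 1
    once = exactCover⇒coverCount≡1 C cover

    ∣S∣≡q : ∑[ j < t ] 𝟙 (lookup S j) ≡ q
    ∣S∣≡q = *-cancelˡ-≡ _ q 3 (begin
      3 * ∑[ j < t ] 𝟙 (lookup S j)    ≡⟨ ∑-coverCount C ∣C∣≡3 S ⟨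
      ∑[ i < 3 * q ] coverCount C S i  ≡⟨ sum-cong-≗ once ⟩
      ∑[ i < 3 * q ] 1                 ≡⟨ ∑-const (3 * q) 1 ⟩
      3 * q * 1                        ≡⟨ *-identityʳ (3 * q) ⟩
      3 * q                            ∎)
      where open ≡-Reasoning

    weight≡7q : weight G f ≡ 7 * q
    weight≡7q = trans (weight≡ f (sum-replicate-zero (3 * q)) (∑-const (3 * q) 1) (∑-const (3 * q) 1) ∣S∣≡q
                                 (sum-replicate-zero m) (sum-replicate-zero m))
                      (total q)
      where
      total : ∀ q → 3 * q * 1 + (3 * q * 1 + (q + 0)) ≡ 7 * q
      total = solve-∀

    3≤∑1 : Fin t → 3 ≤ ∑[ i < 3 * q ] 1
    3≤∑1 j = begin
      3                 ≡⟨ ∣C∣≡3 j ⟨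
      ∣ C j ∣           ≤⟨ ∣p∣≤n (C j) ⟩
      3 * q             ≡⟨ *-identityʳ (3 * q) ⟨
      3 * q * 1         ≡⟨ ∑-const (3 * q) 1 ⟨
      ∑[ i < 3 * q ] 1  ∎
      where open ≤-Reasoning

    coveringSet : Fin (3 * q) → Fin t
    coveringSet i = proj₁ (proj₁ (covers i))

    nbSum-x≡3 : ∀ i → nbSum G f (x i) ≡ 3
    nbSum-x≡3 i = trans (nbSum-x f i) (cong (λ s → 1 + (1 + s))
                    (trans (sum-cong-≗ λ j → sym (𝟙-∧ (lookup S j) (inC i j))) (once i)))

    tripleSum-1≡3 : ∀ k → tripleSum (λ _ → 1) k ≡ 3
    tripleSum-1≡3 k = trans (∑-∈ (triple k) 1) (trans (*-identityʳ _) (∣triple∣≡3 k))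

    2≤ : ∀ {s} → 3 ≤ s → 2 ≤ s
    2≤ = ≤-trans (n≤1+n 2)

    dominating : IsR3DF G f
    dominating (x i)   = z≤n , (λ _ → ≤-reflexive (sym (nbSum-x≡3 i))) , λ ()
    dominating (a i)   = s≤s z≤n , (λ ()) , λ _ → 2≤ (≤-trans (3≤∑1 (coveringSet i)) (∑b≤weight _))
    dominating (b i)   = s≤s z≤n , (λ ()) , λ _ → 2≤ (≤-trans (3≤∑1 (coveringSet i)) (∑a≤weight _))
    dominating (c j)   = ≤-trans (𝟙≤1 (lookup S j)) (s≤s z≤n) , (λ _ → c-bound) , λ _ → 2≤ c-bound
      where
      c-bound : 3 ≤ nbSum G f (c j)
      c-bound = ≤-trans (3≤∑1 j) (∑a≤weight _)
    dominating (y ℓ k) = z≤n , (λ _ → ≤-reflexive (sym (trans (nbSum-y f ℓ k) (tripleSum-1≡3 k)))) , λ ()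
    dominating (z ℓ k) = z≤n , (λ _ → ≤-reflexive (sym (trans (nbSum-z f ℓ k) (tripleSum-1≡3 k)))) , λ ()

module Backward {q t m : ℕ} (q≡2m : q ≡ 2 * m)
                (C : Fin t → Subset (3 * q)) (∣C∣≡3 : ∀ j → ∣ C j ∣ ≡ 3)
                (πA πB : Fin (3 * q) ↔ (Fin m × Fin 6)) where
  open Construction C πA πB
  open Reduction C πA πB

  R3DF⇒exactCover : HasR3DFOfWeight G (7 * q) → ExactCover C
  R3DF⇒exactCover (f , dominating , weight≡7q) = coverCount≡1⇒exactCover C S coveredOnce
    where
    N : ℕ
    N = 3 * q
    S : Subset t
    S = Vec.tabulate (λ j → 1 ≤ᵇ f (c j))
    K : Fin N → ℕ
    K = coverCount C S
    rest : Fin N → ℕ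
    rest i = f (x i) + (heavy (f (a i)) + heavy (f (b i)))

    X A B Γ Y Z HA HB D ∑K : ℕ
    X  = ∑[ i < N ] f (x i)
    A  = ∑[ i < N ] f (a i)
    B  = ∑[ i < N ] f (b i)
    Γ  = ∑[ j < t ] f (c j)
    Y  = ∑[ ℓ < m ] ∑[ k < 20 ] f (y ℓ k)
    Z  = ∑[ ℓ < m ] ∑[ k < 20 ] f (z ℓ k)
    HA = ∑[ i < N ] heavy (f (a i))
    HB = ∑[ i < N ] heavy (f (b i))
    D  = ∑[ i < N ] (K i ∸ 1)
    ∑K = ∑[ i < N ] K i

    label≤3 : ∀ u → f u ≤ 3
    label≤3 u = proj₁ (dominating u)

    cov≤3K : ∀ i → ∑[ j < t ] (if inC i j then f (c j) else 0) ≤ 3 * K i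
    cov≤3K i = ≤-trans (∑-mono-≤ term)
                       (≤-reflexive (sym (*-distribˡ-sum 3 λ j → 𝟙 (lookup S j ∧ lookup (C j) i))))
      where
      bound : ∀ g β → g ≤ 3 → (if β then g else 0) ≤ 3 * 𝟙 ((1 ≤ᵇ g) ∧ β)
      bound 0       true  _   = z≤n
      bound 0       false _   = z≤n
      bound (suc _) true  g≤3 = g≤3
      bound (suc _) false _   = z≤n
      term : ∀ j → (if inC i j then f (c j) else 0) ≤ 3 * 𝟙 (lookup S j ∧ lookup (C j) i)
      term j rewrite lookup∘tabulate (λ j → 1 ≤ᵇ f (c j)) j = bound (f (c j)) (inC i j) (label≤3 (c j))

    element : ∀ i → 1 + (K i ∸ 1) ≤ K i + rest i
    element i = element-bound (K i) (f (x i)) (f (a i)) (f (b i)) _ (cov≤3K i)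
                  (λ fx≡0 → subst (3 ≤_) (nbSum-x f i) (proj₁ (proj₂ (dominating (x i))) fx≡0))

    boundA : m * 12 + HA ≤ 2 * (A + Z)
    boundA = blocks-bound πA (f ∘ a) (λ ℓ k → f (z ℓ k)) (label≤3 ∘ a)
               (λ ℓ k → subst (λ s → minLabel s ≤ f (z ℓ k)) (nbSum-z f ℓ k)
                              (minLabel-≤ G dominating (z ℓ k)))

    boundB : m * 12 + HB ≤ 2 * (B + Y)
    boundB = blocks-bound πB (f ∘ b) (λ ℓ k → f (y ℓ k)) (label≤3 ∘ b)
               (λ ℓ k → subst (λ s → minLabel s ≤ f (y ℓ k)) (nbSum-y f ℓ k)
                              (minLabel-≤ G dominating (y ℓ k)))

    ∑rest : ∑[ i < N ] rest i ≡ X + (HA + HB)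
    ∑rest = trans (∑-distrib-+ (f ∘ x) _) (cong (X +_) (∑-distrib-+ (heavy ∘ f ∘ a) (heavy ∘ f ∘ b)))

    boundX : 6 * m + D ≤ ∑K + (X + (HA + HB))
    boundX = begin
      6 * m + D                         ≡⟨ cong (_+ D) N≡6m ⟨
      ∑[ i < N ] 1 + D                  ≡⟨ ∑-distrib-+ (λ _ → 1) (λ i → K i ∸ 1) ⟨
      ∑[ i < N ] (1 + (K i ∸ 1))        ≤⟨ ∑-mono-≤ element ⟩
      ∑[ i < N ] (K i + rest i)         ≡⟨ ∑-distrib-+ K rest ⟩
      ∑K + ∑[ i < N ] rest i            ≡⟨ cong (∑K +_) ∑rest ⟩
      ∑K + (X + (HA + HB))              ∎
      where
      open ≤-Reasoning
      N≡6m : ∑[ i < N ] 1 ≡ 6 * m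
      N≡6m = trans (∑-const N 1) (trans (*-identityʳ N) (trans (cong (3 *_) q≡2m) (sym (*-assoc 3 2 m))))

    ∑K≤3Γ : ∑K ≤ 3 * Γ
    ∑K≤3Γ = ≤-trans (≤-reflexive (∑-coverCount C ∣C∣≡3 S)) (*-monoʳ-≤ 3 (∑-mono-≤ chosen≤))
      where
      𝟙[1≤ᵇ]≤ : ∀ g → 𝟙 (1 ≤ᵇ g) ≤ g
      𝟙[1≤ᵇ]≤ 0       = z≤n
      𝟙[1≤ᵇ]≤ (suc _) = s≤s z≤n
      chosen≤ : ∀ j → 𝟙 (lookup S j) ≤ f (c j)
      chosen≤ j rewrite lookup∘tabulate (λ j → 1 ≤ᵇ f (c j)) j = 𝟙[1≤ᵇ]≤ (f (c j))

    weight≡14m : X + (A + (B + (Γ + (Y + Z)))) ≡ 14 * m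
    weight≡14m = trans (sym (weight≡ f refl refl refl refl refl refl))
                       (trans weight≡7q (trans (cong (7 *_) q≡2m) (sym (*-assoc 7 2 m))))

    slack≡0 : ∀ i → (K i ∸ 1) + rest i ≡ 0
    slack≡0 = ∑≡0⇒≡0 _ (trans (∑-distrib-+ (λ i → K i ∸ 1) rest) (trans (cong (D +_) ∑rest)
                (weight-budget m X A B Γ Y Z HA HB D ∑K weight≡14m boundA boundB boundX ∑K≤3Γ)))

    coveredOnce : ∀ i → K i ≡ 1
    coveredOnce i = tight (K i) (rest i) (slack≡0 i) (element i)
      where
      tight : ∀ K r → (K ∸ 1) + r ≡ 0 → 1 + (K ∸ 1) ≤ K + r → K ≡ 1
      tight 1             _       _  _  = refl
      tight 0             0       _  ()
      tight 0             (suc _) () _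
      tight (suc (suc _)) _       () _

lemma2 : (q m t : ℕ) → q ≡ 2 * m →
    (C : Fin t → Subset (3 * q)) → ((j : Fin t) → ∣ C j ∣ ≡ 3) →
    (πA πB : Fin (3 * q) ↔ (Fin m × Fin 6)) →
    ExactCover {3 * q} {t} C
      ⇔ HasR3DFOfWeight (Construction.G {3 * q} {t} {m} C πA πB) (7 * q)
lemma2 q m t q≡2m C ∣C∣≡3 πA πB =
  mk⇔ (Forward.exactCover⇒R3DF q C ∣C∣≡3 πA πB) (Backward.R3DF⇒exactCover q≡2m C ∣C∣≡3 πA πB)
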